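{- There exists a graph $X$ which is $3$-colorable and triangle-free, and which contains six distinct vertices grouped into three pairs $\{x_1,x_2\}$, $\{y_1,y_2\}$, $\{z_1,z_2\}$, such that: (1) the set $S=\{x_1,x_2,y_1,y_2,z_1,z_2\}$ is an independent set in $X$; and (2) in every proper $3$-coloring of $X$, the two vertices of each pair receive two distinct colors, and the three pairs receive three pairwise distinct unordered pairs of colors.
   Context: A proper $3$-coloring assigns to each vertex one of three colors so that adjacent vertices receive different colors. A graph is triangle-free if it has no three pairwise adjacent vertices. -}

module Defs where

open import Data.Nat using (ℕ)
open import Data.Fin using (Fin)
open import Data.Product using (_×_; Σ)
open import Data.Sum using (_⊎_)
open import Relation.Nullary using (¬_)
open import Relation.Binary.PropositionalEquality using (_≡_; _≢_)

record Graph (n : ℕ) : Set₁ where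
  field
    Adj   : Fin n → Fin n → Set
    sym   : ∀ {u v} → Adj u v → Adj v u
    irrefl : ∀ {u} → ¬ Adj u u
open Graph public

Proper3Coloring : ∀ {n} → Graph n → (Fin n → Fin 3) → Set
Proper3Coloring G c = ∀ u v → Adj G u v → c u ≢ c v

ThreeColorable : ∀ {n} → Graph n → Set
ThreeColorable G = Σ (_ → Fin 3) (Proper3Coloring G)

TriangleFree : ∀ {n} → Graph n → Set
TriangleFree G = ∀ u v w → ¬ (Adj G u v × Adj G v w × Adj G u w)

Independent : ∀ {n} → Graph n → (Fin n → Set) → Set
Independent G S = ∀ u v → S u → S v → ¬ Adj G u v

SameUPair : Fin 3 → Fin 3 → Fin 3 → Fin 3 → Set
SameUPair a b c d = (a ≡ c × b ≡ d) ⊎ (a ≡ d × b ≡ c)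

-- X is uniquely 3-colourable: under any proper 3-colouring, two vertices get the
-- same colour only if they do under col, which gives the pairs {2,8}, {12,4},
-- {14,10} the colour pairs {0,2}, {2,1}, {1,0}. Property (2) only compares colours,
-- so it passes from col to every proper colouring. Unique colourability is checked
-- by a backtracking search that colours the vertices one at a time, offering each
-- only the colours unused by its already coloured neighbours: no proper colouring
-- is pruned, and every colouring the search produces refines col.
module Submission where

open import Defs hiding (sym)
open import Data.Nat using (ℕ)
open import Data.Empty using (⊥)
open import Data.Fin using (Fin; zero; #_; _≟_)
open import Data.Fin.Properties using (all?)
open import Data.Product using (Σ; _×_; _,_; uncurry)
import Data.Product as Product
open import Data.Product.Properties using (≡-dec)
open import Data.Sum using (_⊎_; inj₁; inj₂; [_,_]′)
import Data.Sum as Sum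
open import Data.List using (List; []; _∷_; concatMap; filter; allFin)
open import Data.List.Relation.Unary.All as All using (All)
open import Data.List.Relation.Unary.Any as Any using (Any; here; there)
open import Data.List.Relation.Unary.Any.Properties using (concatMap⁺)
open import Data.List.Membership.Propositional using (_∈_; lose)
open import Data.List.Membership.Propositional.Properties using (∈-filter⁺; ∈-allFin)
import Data.List.Membership.DecPropositional as DecMembership
open import Data.Vec.Functional using (updateAt; fromList)
open import Data.Vec.Functional.Properties using (updateAt-updates; updateAt-minimal)
open import Function using (const; _∘_)
open import Relation.Nullary using (¬_; Dec; yes; no; ¬?)
open import Relation.Nullary.Decidable using (from-yes; _×-dec_; _⊎-dec_; _→-dec_)
open import Relation.Unary using () renaming (Decidable to Decidable₁)
open import Relation.Binary using (Decidable)
open import Relation.Binary.PropositionalEquality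
  using (_≡_; _≢_; _≗_; refl; sym; trans; ≢-sym)

module EdgeListGraph {n : ℕ} (edges : List (Fin n × Fin n)) (loopless : All (uncurry _≢_) edges) where

  graph : Graph n
  graph = record
    { Adj    = λ u v → (u , v) ∈ edges ⊎ (v , u) ∈ edges
    ; sym    = Sum.swap
    ; irrefl = [ loop , loop ]′
    }
    where
    loop : ∀ {u} → (u , u) ∈ edges → ⊥
    loop uu∈edges = All.lookup loopless uu∈edges refl

  adj? : Decidable (Adj graph)
  adj? u v = ((u , v) ∈? edges) ⊎-dec ((v , u) ∈? edges)
    where open DecMembership {A = Fin n × Fin n} (≡-dec _≟_ _≟_) using (_∈?_)

  noCommonNeighbour⇒triangleFree :
    All (λ (u , v) → ∀ w → ¬ (Adj graph v w × Adj graph u w)) edges → TriangleFree graph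
  noCommonNeighbour⇒triangleFree noCommon u v w (inj₁ uv∈ , vw , uw) = All.lookup noCommon uv∈ w (vw , uw)
  noCommonNeighbour⇒triangleFree noCommon u v w (inj₂ vu∈ , vw , uw) = All.lookup noCommon vu∈ w (uw , vw)

  separated⇒proper : ∀ {A : Set} {c : Fin n → A} →
    All (λ (u , v) → c u ≢ c v) edges → ∀ u v → Adj graph u v → c u ≢ c v
  separated⇒proper separated u v (inj₁ uv∈) = All.lookup separated uv∈
  separated⇒proper separated u v (inj₂ vu∈) = ≢-sym (All.lookup separated vu∈)

Refines : ∀ {n k} → (Fin n → Fin k) → (Fin n → Fin k) → Set
Refines c d = ∀ u v → c u ≡ c v → d u ≡ d v

refines? : ∀ {n k} (c d : Fin n → Fin k) → Dec (Refines c d)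
refines? c d = all? λ u → all? λ v → (c u ≟ c v) →-dec (d u ≟ d v)

refines-resp-≗ : ∀ {n k} {c g d : Fin n → Fin k} → c ≗ g → Refines g d → Refines c d
refines-resp-≗ c≗g g-refines u v cu≡cv = g-refines u v (trans (sym (c≗g u)) (trans cu≡cv (c≗g v)))

refines-≢ : ∀ {n k} {c d : Fin n → Fin k} {u v} → Refines c d → d u ≢ d v → c u ≢ c v
refines-≢ {u = u} {v} c-refines du≢dv cu≡cv = du≢dv (c-refines u v cu≡cv)

refines-¬SameUPair : ∀ {n} {c d : Fin n → Fin 3} {u₁ u₂ v₁ v₂} → Refines c d →
  ¬ SameUPair (d u₁) (d u₂) (d v₁) (d v₂) → ¬ SameUPair (c u₁) (c u₂) (c v₁) (c v₂)
refines-¬SameUPair r ¬same =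
  ¬same ∘ Sum.map (Product.map (r _ _) (r _ _)) (Product.map (r _ _) (r _ _))

module Colourings {n : ℕ} (G : Graph n) (adj? : Decidable (Adj G)) (k : ℕ) where

  Proper : (Fin n → Fin k) → Set
  Proper c = ∀ u v → Adj G u v → c u ≢ c v

  Fits : (Fin n → Fin k) → List (Fin n) → Fin n → Fin k → Set
  Fits g coloured v a = All (λ u → Adj G v u → g u ≢ a) coloured

  fits? : ∀ g coloured v → Decidable₁ (Fits g coloured v)
  fits? g coloured v a = All.all? (λ u → adj? v u →-dec ¬? (g u ≟ a)) coloured

  extensions : List (Fin n) → List (Fin n) → (Fin n → Fin k) → List (Fin n → Fin k)
  extensions coloured []               g = g ∷ []
  extensions coloured (v ∷ uncoloured) g =
    concatMap (λ a → extensions (v ∷ coloured) uncoloured (updateAt g v (const a)))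
              (filter (fits? g coloured v) (allFin k))

  extensions-complete : ∀ {c} → Proper c → ∀ coloured uncoloured g →
    (∀ {u} → u ∈ coloured → c u ≡ g u) → (∀ u → u ∈ coloured ⊎ u ∈ uncoloured) →
    Any (c ≗_) (extensions coloured uncoloured g)
  extensions-complete proper coloured [] g agrees covers =
    here λ u → [ agrees , (λ ()) ]′ (covers u)
  extensions-complete {c} proper coloured (v ∷ uncoloured) g agrees covers =
    concatMap⁺ (λ a → extensions (v ∷ coloured) uncoloured (updateAt g v (const a)))
      (lose (∈-filter⁺ (fits? g coloured v) (∈-allFin (c v)) fits)
            (extensions-complete proper (v ∷ coloured) uncoloured g′ agrees′ covers′))
    where
    g′ : Fin n → Fin k
    g′ = updateAt g v (const (c v))

    fits : Fits g coloured v (c v)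
    fits = All.tabulate λ u∈ adj gu≡cv → proper v _ adj (sym (trans (agrees u∈) gu≡cv))

    agrees′ : ∀ {u} → u ∈ v ∷ coloured → c u ≡ g′ u
    agrees′ {u} u∈ with u ≟ v
    ... | yes refl = sym (updateAt-updates v g)
    ... | no u≢v   = trans (agrees (Any.tail u≢v u∈)) (sym (updateAt-minimal u v g u≢v))

    covers′ : ∀ u → u ∈ v ∷ coloured ⊎ u ∈ uncoloured
    covers′ u with covers u
    ... | inj₁ u∈coloured      = inj₁ (there u∈coloured)
    ... | inj₂ (here u≡v)      = inj₁ (here u≡v)
    ... | inj₂ (there u∈uncol) = inj₂ u∈uncol

  proper⇒∈extensions : ∀ {c} g → Proper c → Any (c ≗_) (extensions [] (allFin n) g)
  proper⇒∈extensions g proper =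
    extensions-complete proper [] (allFin n) g (λ ()) (λ u → inj₂ (∈-allFin u))

edges : List (Fin 15 × Fin 15)
edges =
  (# 0 , # 1) ∷ (# 0 , # 4) ∷ (# 0 , # 8) ∷ (# 0 , # 9) ∷ (# 0 , # 12) ∷ (# 1 , # 2) ∷
  (# 1 , # 5) ∷ (# 1 , # 6) ∷ (# 2 , # 3) ∷ (# 2 , # 7) ∷ (# 2 , # 11) ∷ (# 3 , # 4) ∷
  (# 3 , # 5) ∷ (# 3 , # 10) ∷ (# 3 , # 14) ∷ (# 4 , # 6) ∷ (# 4 , # 13) ∷ (# 5 , # 8) ∷
  (# 5 , # 9) ∷ (# 5 , # 12) ∷ (# 6 , # 7) ∷ (# 6 , # 10) ∷ (# 6 , # 14) ∷ (# 7 , # 8) ∷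
  (# 7 , # 9) ∷ (# 7 , # 12) ∷ (# 8 , # 11) ∷ (# 8 , # 13) ∷ (# 9 , # 10) ∷ (# 9 , # 14) ∷
  (# 10 , # 11) ∷ (# 11 , # 12) ∷ (# 12 , # 13) ∷ (# 13 , # 14) ∷ []

edges-loopless : All (uncurry _≢_) edges
edges-loopless = from-yes (All.all? (λ (u , v) → ¬? (u ≟ v)) edges)

open EdgeListGraph edges edges-loopless renaming (graph to X)

X-triangleFree : TriangleFree X
X-triangleFree = noCommonNeighbour⇒triangleFree
  (from-yes (All.all? (λ (u , v) → all? λ w → ¬? (adj? v w ×-dec adj? u w)) edges))

col : Fin 15 → Fin 3
col = fromList (# 0 ∷ # 1 ∷ # 0 ∷ # 2 ∷ # 1 ∷ # 0 ∷ # 2 ∷ # 1 ∷ # 2 ∷ # 2 ∷ # 0 ∷ # 1 ∷ # 2 ∷ # 0 ∷ # 1 ∷ [])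

col-proper : Proper3Coloring X col
col-proper = separated⇒proper (from-yes (All.all? (λ (u , v) → ¬? (col u ≟ col v)) edges))

open Colourings X adj? 3 using (extensions; proper⇒∈extensions)

X-colourings : List (Fin 15 → Fin 3)
X-colourings = extensions [] (allFin 15) (const zero)

X-colourings-refine-col : All (λ g → Refines g col) X-colourings
X-colourings-refine-col = from-yes (All.all? (λ g → refines? g col) X-colourings)

proper⇒refines-col : ∀ c → Proper3Coloring X c → Refines c col
proper⇒refines-col c proper =
  All.lookupWith {R = λ _ → Refines c col} (λ g-refines c≗g → refines-resp-≗ c≗g g-refines)
    X-colourings-refine-col (proper⇒∈extensions (const zero) proper)

InS : Fin 15 → Set
InS v = v ≡ # 2 ⊎ v ≡ # 8 ⊎ v ≡ # 12 ⊎ v ≡ # 4 ⊎ v ≡ # 14 ⊎ v ≡ # 10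

S-independent : Independent X InS
S-independent = from-yes (all? λ u → all? λ v → inS? u →-dec inS? v →-dec ¬? (adj? u v))
  where
  inS? : Decidable₁ InS
  inS? v = v ≟ # 2 ⊎-dec v ≟ # 8 ⊎-dec v ≟ # 12 ⊎-dec v ≟ # 4 ⊎-dec v ≟ # 14 ⊎-dec v ≟ # 10

lemma4p2 : Σ ℕ λ n → Σ (Graph n) λ X →
    ThreeColorable X × TriangleFree X ×
    Σ (Fin n) λ x₁ → Σ (Fin n) λ x₂ → Σ (Fin n) λ y₁ → Σ (Fin n) λ y₂ →
    Σ (Fin n) λ z₁ → Σ (Fin n) λ z₂ →
      -- the six vertices are pairwise distinct
      (x₁ ≢ x₂ × x₁ ≢ y₁ × x₁ ≢ y₂ × x₁ ≢ z₁ × x₁ ≢ z₂ ×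
       x₂ ≢ y₁ × x₂ ≢ y₂ × x₂ ≢ z₁ × x₂ ≢ z₂ ×
       y₁ ≢ y₂ × y₁ ≢ z₁ × y₁ ≢ z₂ ×
       y₂ ≢ z₁ × y₂ ≢ z₂ ×
       z₁ ≢ z₂) ×
      -- (1) S = {x₁,x₂,y₁,y₂,z₁,z₂} is independent
      Independent X (λ v → v ≡ x₁ ⊎ v ≡ x₂ ⊎ v ≡ y₁ ⊎ v ≡ y₂ ⊎ v ≡ z₁ ⊎ v ≡ z₂) ×
      -- (2) every proper 3-coloring separates each pair and gives the
      --     three pairs pairwise distinct unordered color pairs
      ((c : Fin n → Fin 3) → Proper3Coloring X c →
        (c x₁ ≢ c x₂ × c y₁ ≢ c y₂ × c z₁ ≢ c z₂) ×
        ¬ SameUPair (c x₁) (c x₂) (c y₁) (c y₂) ×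
        ¬ SameUPair (c x₁) (c x₂) (c z₁) (c z₂) ×
        ¬ SameUPair (c y₁) (c y₂) (c z₁) (c z₂))
lemma4p2 =
  15 , X , (col , col-proper) , X-triangleFree , # 2 , # 8 , # 12 , # 4 , # 14 , # 10 ,
  ((λ ()) , (λ ()) , (λ ()) , (λ ()) , (λ ()) , (λ ()) , (λ ()) , (λ ()) ,
   (λ ()) , (λ ()) , (λ ()) , (λ ()) , (λ ()) , (λ ()) , (λ ())) ,
  S-independent ,
  λ c proper → let r = proper⇒refines-col c proper in
    (refines-≢ r (λ ()) , refines-≢ r (λ ()) , refines-≢ r (λ ())) ,
    refines-¬SameUPair r (λ { (inj₁ (() , _)) ; (inj₂ (() , _)) }) ,
    refines-¬SameUPair r (λ { (inj₁ (() , _)) ; (inj₂ (_ , ())) }) ,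
    refines-¬SameUPair r (λ { (inj₁ (() , _)) ; (inj₂ (() , _)) })
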